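{- Let $m\geq 2$ and let $G=K_{p_1,p_2,\ldots,p_m}$ be the complete multipartite graph with $m$ partite sets of sizes $p_1\geq p_2\geq\cdots\geq p_m\geq 1$, and let $n=p_1+p_2+\cdots+p_m$. Then $min_D(G)=\left\lceil\dfrac{n-p_1}{2}\right\rceil$.
   Context: All graphs are finite and simple. In the irreversible majority conversion process on a graph $G$, every vertex is black or white at each discrete time step $t=0,1,2,\ldots$. A black vertex stays black forever. A white vertex $v$ of degree $\deg_G(v)\geq 1$ becomes black at time $t$ if at least $\deg_G(v)/2$ of its neighbors are black at time $t-1$. An isolated vertex never changes color. A dynamo (dynamic monopoly) of $G$ is a set $D\subseteq V(G)$ such that, if exactly the vertices of $D$ are black at time $0$, then every vertex of $G$ is eventually black. $min_D(G)$ denotes the minimum size of a dynamo of $G$. -}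

module Defs where

open import Data.Nat using (ℕ; zero; suc; _≤_; _*_; _≤?_; _∸_; ⌈_/2⌉)
open import Data.Bool using (Bool; true; false; _∨_; _∧_; not)
open import Data.Fin using (Fin; toℕ; _≟_)
open import Data.Fin.Subset using (Subset; _∩_; ∣_∣)
open import Data.Vec using (Vec; tabulate; lookup; sum)
open import Data.Product using (Σ; ∃; _×_)
open import Relation.Nullary.Decidable using (isYes)
open import Relation.Binary.PropositionalEquality using (_≡_; refl; sym)
open import Relation.Nullary using (yes; no)
open import Data.Empty using (⊥-elim)

record Graph (N : ℕ) : Set where
  field
    adj   : Fin N → Fin N → Bool
    adj-sym   : ∀ u v → adj u v ≡ adj v u
    adj-irrefl : ∀ v → adj v v ≡ false
open Graph public

nbrs : ∀ {N} → Graph N → Fin N → Subset N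
nbrs G v = tabulate (adj G v)

deg : ∀ {N} → Graph N → Fin N → ℕ
deg G v = ∣ nbrs G v ∣

blackNbrs : ∀ {N} → Graph N → Subset N → Fin N → ℕ
blackNbrs G S v = ∣ nbrs G v ∩ S ∣

step : ∀ {N} → Graph N → Subset N → Subset N
step G S = tabulate λ v →
  lookup S v ∨ (isYes (1 ≤? deg G v) ∧ isYes (deg G v ≤? 2 * blackNbrs G S v))

state : ∀ {N} → Graph N → Subset N → ℕ → Subset N
state G D zero    = D
state G D (suc t) = step G (state G D t)

IsDynamo : ∀ {N} → Graph N → Subset N → Set
IsDynamo G D = ∀ v → ∃ λ t → lookup (state G D t) v ≡ true

IsMinDynamoSize : ∀ {N} → Graph N → ℕ → Set
IsMinDynamoSize G k =
  (∃ λ D → IsDynamo G D × ∣ D ∣ ≡ k) × (∀ D → IsDynamo G D → k ≤ ∣ D ∣)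

multipartite : ∀ {N m} → (Fin N → Fin m) → Graph N
multipartite {N} {m} f = record
  { adj = λ u v → not (isYes (f u ≟ f v))
  ; adj-sym = symP
  ; adj-irrefl = irr }
  where
  symP : ∀ u v → not (isYes (f u ≟ f v)) ≡ not (isYes (f v ≟ f u))
  symP u v with f u ≟ f v | f v ≟ f u
  ... | yes _ | yes _ = refl
  ... | no _  | no _  = refl
  ... | yes p | no q  = ⊥-elim (q (sym p))
  ... | no q  | yes p = ⊥-elim (q (sym p))
  irr : ∀ v → not (isYes (f v ≟ f v)) ≡ false
  irr v with f v ≟ f v
  ... | yes _ = refl
  ... | no q = ⊥-elim (q refl)

partSize : ∀ {N m} → (Fin N → Fin m) → Fin m → ℕ
partSize f i = ∣ tabulate (λ v → isYes (f v ≟ i)) ∣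

-- Let δ = n − p₁ be the number of vertices outside a largest part; every vertex has degree
-- n − pᵢ ≥ δ. A black set of fewer than δ/2 vertices is stable, since no white vertex can see
-- half of its neighbours black, so it is not a dynamo. Conversely, seed ⌈δ/2⌉ vertices outside
-- the largest part. After one round the whole largest part, whose vertices have degree exactly δ,
-- is black; after the second, a vertex of part i sees the largest part together with the seed
-- vertices outside part i, which is at least half of its n − pᵢ neighbours because pᵢ ≤ p₁.
module Submission where

open import Defs
open import Data.Nat using (ℕ; suc; _∸_; ⌈_/2⌉) renaming (_≤_ to _≤ℕ_)
open import Data.Fin using (Fin; zero) renaming (_≤_ to _≤F_)
open import Data.Vec using (tabulate; sum)
open import Relation.Binary.PropositionalEquality using (_≡_)

open import Data.Nat using (zero; _+_; _*_; _⊓_; _≤_; _<_; z≤n; s≤s; _≤?_; ⌊_/2⌋)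
open import Data.Nat.Properties hiding (_≟_)
open import Data.Nat.Tactic.RingSolver using (solve-∀)
open import Algebra.Properties.CommutativeSemigroup +-commutativeSemigroup
  using () renaming (interchange to +-interchange)
open import Data.Bool using (Bool; true; false; _∨_; _∧_; not; if_then_else_)
open import Data.Bool.Properties using (∧-conicalˡ; ∧-conicalʳ; ∧-zeroʳ; ∨-zeroʳ)
open import Data.Fin using (suc; _≟_)
open import Data.Fin.Subset using (Subset; _∩_; ∣_∣; ⊤)
open import Data.Fin.Subset.Properties using (∣p∩q∣≤∣q∣; p⊆q⇒∣p∣≤∣q∣; ∣⊤∣≡n)
open import Data.Vec using ([]; _∷_; lookup)
open import Data.Vec.Properties using (tabulate-cong; tabulate∘lookup; lookup∘tabulate; lookup⇒[]=)
open import Data.Product using (_,_)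
open import Function using (_∘_)
open import Relation.Binary.PropositionalEquality
  using (_≢_; refl; sym; trans; cong; cong₂; subst; subst₂; module ≡-Reasoning)
open import Relation.Nullary using (¬_; Dec; yes; no; contradiction)
open import Relation.Nullary.Decidable using (isYes; isYes≗does; dec-true; dec-false)

private
  variable
    N : ℕ

A⇒isYes≡true : ∀ {A : Set} (a? : Dec A) → A → isYes a? ≡ true
A⇒isYes≡true a? a = trans (isYes≗does a?) (dec-true a? a)

¬A⇒isYes≡false : ∀ {A : Set} (a? : Dec A) → ¬ A → isYes a? ≡ false
¬A⇒isYes≡false a? ¬a = trans (isYes≗does a?) (dec-false a? ¬a)

isYes≡true⇒A : ∀ {A : Set} (a? : Dec A) → isYes a? ≡ true → A
isYes≡true⇒A (yes a) _ = a

-- deg and partSize from Defs are, definitionally, count of a predicate.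
count : (Fin N → Bool) → ℕ
count P = ∣ tabulate P ∣

count-cong : {P Q : Fin N → Bool} → (∀ u → P u ≡ Q u) → count P ≡ count Q
count-cong P≗Q = cong ∣_∣ (tabulate-cong P≗Q)

count-mono : {P Q : Fin N → Bool} → (∀ u → P u ≡ true → Q u ≡ true) → count P ≤ count Q
count-mono {zero}  P⇒Q = z≤n
count-mono {suc N} {P} {Q} P⇒Q with P zero in eP | Q zero in eQ
... | true  | true  = s≤s (count-mono (P⇒Q ∘ suc))
... | false | true  = m≤n⇒m≤1+n (count-mono (P⇒Q ∘ suc))
... | false | false = count-mono (P⇒Q ∘ suc)
... | true  | false with () ← trans (sym (P⇒Q zero eP)) eQ

count+count-not : (P : Fin N → Bool) → count P + count (not ∘ P) ≡ N
count+count-not {zero}  P = refl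
count+count-not {suc N} P with P zero
... | true  = cong suc (count+count-not (P ∘ suc))
... | false = trans (+-suc _ _) (cong suc (count+count-not (P ∘ suc)))

count-∧-split : (P Q : Fin N → Bool) →
  count P ≡ count (λ u → P u ∧ Q u) + count (λ u → P u ∧ not (Q u))
count-∧-split {zero}  P Q = refl
count-∧-split {suc N} P Q with P zero | Q zero
... | true  | true  = cong suc (count-∧-split (P ∘ suc) (Q ∘ suc))
... | true  | false = trans (cong suc (count-∧-split (P ∘ suc) (Q ∘ suc))) (sym (+-suc _ _))
... | false | _     = count-∧-split (P ∘ suc) (Q ∘ suc)

count-∨-disjoint : (P Q : Fin N → Bool) → (∀ u → P u ∧ Q u ≡ false) →
  count (λ u → P u ∨ Q u) ≡ count P + count Q
count-∨-disjoint {zero}  P Q disj = refl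
count-∨-disjoint {suc N} P Q disj with P zero in eP | Q zero in eQ
... | true  | true  with () ← trans (sym (cong₂ _∧_ eP eQ)) (disj zero)
... | true  | false = cong suc (count-∨-disjoint (P ∘ suc) (Q ∘ suc) (disj ∘ suc))
... | false | true  = trans (cong suc (count-∨-disjoint (P ∘ suc) (Q ∘ suc) (disj ∘ suc))) (sym (+-suc _ _))
... | false | false = count-∨-disjoint (P ∘ suc) (Q ∘ suc) (disj ∘ suc)

tabulate-∩ : (P : Fin N → Bool) (S : Subset N) → tabulate P ∩ S ≡ tabulate (λ u → P u ∧ lookup S u)
tabulate-∩ P []      = refl
tabulate-∩ P (x ∷ S) = cong (P zero ∧ x ∷_) (tabulate-∩ (P ∘ suc) S)

takeFirst : ℕ → (Fin N → Bool) → Fin N → Bool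
takeFirst zero    Q u       = false
takeFirst (suc b) Q zero    = Q zero
takeFirst (suc b) Q (suc u) = if Q zero then takeFirst b (Q ∘ suc) u else takeFirst (suc b) (Q ∘ suc) u

takeFirst-⊆ : ∀ b (Q : Fin N → Bool) u → takeFirst b Q u ≡ true → Q u ≡ true
takeFirst-⊆ (suc b) Q zero    e = e
takeFirst-⊆ (suc b) Q (suc u) e with Q zero
... | true  = takeFirst-⊆ b (Q ∘ suc) u e
... | false = takeFirst-⊆ (suc b) (Q ∘ suc) u e

count-takeFirst : ∀ b (Q : Fin N → Bool) → count (takeFirst b Q) ≡ b ⊓ count Q
count-takeFirst {zero}  zero    Q = refl
count-takeFirst {zero}  (suc b) Q = refl
count-takeFirst {suc N} zero    Q = count-takeFirst {N} zero (Q ∘ suc)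
count-takeFirst {suc N} (suc b) Q with Q zero
... | true  = cong suc (count-takeFirst b (Q ∘ suc))
... | false = count-takeFirst (suc b) (Q ∘ suc)

b2n : Bool → ℕ
b2n true  = 1
b2n false = 0

count-suc : (P : Fin (suc N) → Bool) → count P ≡ b2n (P zero) + count (P ∘ suc)
count-suc P with P zero
... | true  = refl
... | false = refl

isYes-suc≟suc : ∀ {m} (i j : Fin m) → isYes (suc i ≟ suc j) ≡ isYes (i ≟ j)
isYes-suc≟suc i j = trans (isYes≗does (suc i ≟ suc j)) (sym (isYes≗does (i ≟ j)))

sum-tabulate-+ : ∀ {m} (g h : Fin m → ℕ) →
  sum (tabulate (λ i → g i + h i)) ≡ sum (tabulate g) + sum (tabulate h)
sum-tabulate-+ {zero}  g h = refl
sum-tabulate-+ {suc m} g h =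
  trans (cong (g zero + h zero +_) (sum-tabulate-+ (g ∘ suc) (h ∘ suc))) (+-interchange (g zero) (h zero) _ _)

sum-tabulate-0 : ∀ m → sum (tabulate {n = m} (λ _ → 0)) ≡ 0
sum-tabulate-0 zero    = refl
sum-tabulate-0 (suc m) = sum-tabulate-0 m

sum-indicator : ∀ {m} (j : Fin m) → sum (tabulate (λ i → b2n (isYes (j ≟ i)))) ≡ 1
sum-indicator {suc m} zero    = cong suc (sum-tabulate-0 m)
sum-indicator {suc m} (suc j) =
  trans (cong sum (tabulate-cong (λ i → cong b2n (isYes-suc≟suc j i)))) (sum-indicator j)

sum-partSize : ∀ {m} (f : Fin N → Fin m) → sum (tabulate (partSize f)) ≡ N
sum-partSize {zero}  {m} f = sum-tabulate-0 m
sum-partSize {suc N}     f = begin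
  sum (tabulate (partSize f))
    ≡⟨ cong sum (tabulate-cong (λ i → count-suc (λ v → isYes (f v ≟ i)))) ⟩
  sum (tabulate (λ i → b2n (isYes (f zero ≟ i)) + partSize (f ∘ suc) i))
    ≡⟨ sum-tabulate-+ _ (partSize (f ∘ suc)) ⟩
  sum (tabulate (λ i → b2n (isYes (f zero ≟ i)))) + sum (tabulate (partSize (f ∘ suc)))
    ≡⟨ cong₂ _+_ (sum-indicator (f zero)) (sum-partSize (f ∘ suc)) ⟩
  suc N ∎
  where open ≡-Reasoning

n≤2*⌈n/2⌉ : ∀ n → n ≤ 2 * ⌈ n /2⌉
n≤2*⌈n/2⌉ n = begin
  n                     ≡⟨ ⌊n/2⌋+⌈n/2⌉≡n n ⟨
  ⌊ n /2⌋ + ⌈ n /2⌉     ≤⟨ +-monoˡ-≤ ⌈ n /2⌉ (⌊n/2⌋≤⌈n/2⌉ n) ⟩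
  ⌈ n /2⌉ + ⌈ n /2⌉     ≡⟨ cong (⌈ n /2⌉ +_) (+-identityʳ ⌈ n /2⌉) ⟨
  2 * ⌈ n /2⌉           ∎
  where open ≤-Reasoning

n≤2*m⇒⌈n/2⌉≤m : ∀ {n m} → n ≤ 2 * m → ⌈ n /2⌉ ≤ m
n≤2*m⇒⌈n/2⌉≤m {n} {m} n≤2m =
  subst (⌈ n /2⌉ ≤_) (sym (n≡⌈n+n/2⌉ m)) (⌈n/2⌉-mono (subst (n ≤_) (cong (m +_) (+-identityʳ m)) n≤2m))

-- d = deg v, q = pᵢ with v in part i, p = p₁, s = δ; c and a count the seed inside and outside part i.
second-round-majority : ∀ {d q p s c a} → d + q ≡ p + s → s ≤ 2 * (c + a) → c ≤ q → q ≤ p →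
  d ≤ 2 * (p + a)
second-round-majority {d} {q} {p} {s} {c} {a} degree s≤2[c+a] c≤q q≤p =
  +-cancelʳ-≤ q d (2 * (p + a)) (begin
    d + q                    ≡⟨ degree ⟩
    p + s                    ≤⟨ +-monoʳ-≤ p s≤2[c+a] ⟩
    p + 2 * (c + a)          ≤⟨ +-monoʳ-≤ p (*-monoʳ-≤ 2 (+-monoˡ-≤ a c≤q)) ⟩
    p + 2 * (q + a)          ≡⟨ regroup₁ p q a ⟩
    (q + (p + 2 * a)) + q    ≤⟨ +-monoˡ-≤ q (+-monoˡ-≤ (p + 2 * a) q≤p) ⟩
    (p + (p + 2 * a)) + q    ≡⟨ cong (_+ q) (regroup₂ p a) ⟩
    2 * (p + a) + q          ∎)
  where
  open ≤-Reasoning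
  regroup₁ : ∀ p q a → p + 2 * (q + a) ≡ (q + (p + 2 * a)) + q
  regroup₁ = solve-∀
  regroup₂ : ∀ p a → p + (p + 2 * a) ≡ 2 * (p + a)
  regroup₂ = solve-∀

module Process {N} (G : Graph N) where

  private
    majority : Subset N → Fin N → Bool
    majority S v = isYes (1 ≤? deg G v) ∧ isYes (deg G v ≤? 2 * blackNbrs G S v)

  lookup-step : ∀ S v → lookup (step G S) v ≡ lookup S v ∨ majority S v
  lookup-step S v = lookup∘tabulate _ v

  black-stays-black : ∀ S v → lookup S v ≡ true → lookup (step G S) v ≡ true
  black-stays-black S v black = trans (lookup-step S v) (cong (_∨ majority S v) black)

  majority-blackens : ∀ S v → 1 ≤ deg G v → deg G v ≤ 2 * blackNbrs G S v → lookup (step G S) v ≡ true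
  majority-blackens S v deg≥1 half = begin
    lookup (step G S) v          ≡⟨ lookup-step S v ⟩
    lookup S v ∨ majority S v    ≡⟨ cong (lookup S v ∨_) both ⟩
    lookup S v ∨ true            ≡⟨ ∨-zeroʳ (lookup S v) ⟩
    true                         ∎
    where
    open ≡-Reasoning
    both : majority S v ≡ true
    both = cong₂ _∧_ (A⇒isYes≡true (1 ≤? deg G v) deg≥1) (A⇒isYes≡true (deg G v ≤? 2 * blackNbrs G S v) half)

  step-stable : ∀ S → (∀ v → lookup S v ≡ false → ¬ deg G v ≤ 2 * blackNbrs G S v) → step G S ≡ S
  step-stable S noHalf = trans (tabulate-cong stays) (tabulate∘lookup S)
    where
    stays : ∀ v → lookup S v ∨ majority S v ≡ lookup S v
    stays v with lookup S v in white
    ... | true  = refl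
    ... | false = trans (cong (isYes (1 ≤? deg G v) ∧_) no-half) (∧-zeroʳ _)
      where
      no-half : isYes (deg G v ≤? 2 * blackNbrs G S v) ≡ false
      no-half = ¬A⇒isYes≡false (deg G v ≤? 2 * blackNbrs G S v) (noHalf v white)

  state-stable : ∀ S → step G S ≡ S → ∀ t → state G S t ≡ S
  state-stable S stable zero    = refl
  state-stable S stable (suc t) = trans (cong (step G) (state-stable S stable t)) stable

  stable-dynamo-size : ∀ D → step G D ≡ D → IsDynamo G D → N ≤ ∣ D ∣
  stable-dynamo-size D stable dynamo =
    subst (_≤ ∣ D ∣) (∣⊤∣≡n N) (p⊆q⇒∣p∣≤∣q∣ {p = ⊤} (λ {v} _ → lookup⇒[]= v D (black v)))
    where
    black : ∀ v → lookup D v ≡ true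
    black v with dynamo v
    ... | t , e = subst (λ S → lookup S v ≡ true) (state-stable D stable t) e

  -- δ ≤ N only rules out the empty graph, where every δ bounds the degrees.
  dynamo-lowerBound : ∀ {δ} → δ ≤ N → (∀ v → δ ≤ deg G v) → ∀ D → IsDynamo G D → ⌈ δ /2⌉ ≤ ∣ D ∣
  dynamo-lowerBound {δ} δ≤N minDeg D dynamo with ⌈ δ /2⌉ ≤? ∣ D ∣
  ... | yes bound = bound
  ... | no ¬bound = contradiction (≤-trans δ≤N (≤-trans (stable-dynamo-size D stable dynamo) (m≤m+n ∣ D ∣ _)))
                                  (<⇒≱ sparse)
    where
    sparse : 2 * ∣ D ∣ < δ
    sparse = ≰⇒> (¬bound ∘ n≤2*m⇒⌈n/2⌉≤m)
    stable : step G D ≡ D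
    stable = step-stable D λ v _ half →
      <⇒≱ sparse (≤-trans (minDeg v) (≤-trans half (*-monoʳ-≤ 2 (∣p∩q∣≤∣q∣ (nbrs G v) D))))

module Multipartite {N m} (f : Fin N → Fin m) where

  open Process (multipartite f)

  private
    G = multipartite f

  inPart : Fin m → Fin N → Bool
  inPart i u = isYes (f u ≟ i)

  inPart⁺ : ∀ {i u} → f u ≡ i → inPart i u ≡ true
  inPart⁺ {i} {u} = A⇒isYes≡true (f u ≟ i)

  inPart⁻ : ∀ {i u} → inPart i u ≡ true → f u ≡ i
  inPart⁻ {i} {u} = isYes≡true⇒A (f u ≟ i)

  notInPart⁺ : ∀ {i u} → f u ≢ i → not (inPart i u) ≡ true
  notInPart⁺ {i} {u} f≢i = cong not (¬A⇒isYes≡false (f u ≟ i) f≢i)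

  deg-multipartite : ∀ v → deg G v ≡ count (λ w → not (inPart (f v) w))
  deg-multipartite v = count-cong (adj-sym G v)

  deg+partSize≡N : ∀ v → deg G v + partSize f (f v) ≡ N
  deg+partSize≡N v = begin
    deg G v + partSize f (f v)                           ≡⟨ cong (_+ partSize f (f v)) (deg-multipartite v) ⟩
    count (λ w → not (inPart (f v) w)) + partSize f (f v) ≡⟨ +-comm _ (partSize f (f v)) ⟩
    partSize f (f v) + count (λ w → not (inPart (f v) w)) ≡⟨ count+count-not (inPart (f v)) ⟩
    N                                                     ∎
    where open ≡-Reasoning

  blackNbrs-multipartite : ∀ S v → blackNbrs G S v ≡ count (λ w → not (inPart (f v) w) ∧ lookup S w)
  blackNbrs-multipartite S v =
    trans (cong ∣_∣ (tabulate-∩ (adj G v) S)) (count-cong (λ w → cong (_∧ lookup S w) (adj-sym G v w)))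

  count≤blackNbrs : ∀ S v {P : Fin N → Bool} →
    (∀ w → P w ≡ true → f w ≢ f v) → (∀ w → P w ≡ true → lookup S w ≡ true) → count P ≤ blackNbrs G S v
  count≤blackNbrs S v {P} otherPart black = subst (count P ≤_) (sym (blackNbrs-multipartite S v))
    (count-mono (λ w w∈P → cong₂ _∧_ (notInPart⁺ (otherPart w w∈P)) (black w w∈P)))

  partSize≤outside : ∀ {i r} → i ≢ r → partSize f i ≤ count (λ u → not (inPart r u))
  partSize≤outside {i} {r} i≢r =
    count-mono {P = inPart i} {Q = λ u → not (inPart r u)}
      (λ u u∈i → notInPart⁺ (λ u∈r → i≢r (trans (sym (inPart⁻ u∈i)) u∈r)))

  module LargestPart (r : Fin m) (largest : ∀ i → partSize f i ≤ partSize f r) where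

    outside : Fin N → Bool
    outside u = not (inPart r u)

    δ : ℕ
    δ = count outside

    partSize+δ≡N : partSize f r + δ ≡ N
    partSize+δ≡N = count+count-not (inPart r)

    δ≤deg : ∀ v → δ ≤ deg G v
    δ≤deg v = +-cancelʳ-≤ (partSize f (f v)) δ (deg G v) (begin
      δ + partSize f (f v)          ≤⟨ +-monoʳ-≤ δ (largest (f v)) ⟩
      δ + partSize f r              ≡⟨ +-comm δ (partSize f r) ⟩
      partSize f r + δ              ≡⟨ partSize+δ≡N ⟩
      N                             ≡⟨ deg+partSize≡N v ⟨
      deg G v + partSize f (f v)    ∎)
      where open ≤-Reasoning

    deg≡δ : ∀ {v} → f v ≡ r → deg G v ≡ δ
    deg≡δ {v} v∈r = +-cancelʳ-≡ (partSize f r) (deg G v) δ (begin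
      deg G v + partSize f r        ≡⟨ cong (λ i → deg G v + partSize f i) v∈r ⟨
      deg G v + partSize f (f v)    ≡⟨ deg+partSize≡N v ⟩
      N                             ≡⟨ partSize+δ≡N ⟨
      partSize f r + δ              ≡⟨ +-comm (partSize f r) δ ⟩
      δ + partSize f r              ∎)
      where open ≡-Reasoning

    dynamo-lowerBound-δ : ∀ D → IsDynamo G D → ⌈ δ /2⌉ ≤ ∣ D ∣
    dynamo-lowerBound-δ = dynamo-lowerBound (subst (δ ≤_) partSize+δ≡N (m≤n+m δ (partSize f r))) δ≤deg

    seedP : Fin N → Bool
    seedP = takeFirst ⌈ δ /2⌉ outside

    seed : Subset N
    seed = tabulate seedP

    ∣seed∣≡⌈δ/2⌉ : ∣ seed ∣ ≡ ⌈ δ /2⌉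
    ∣seed∣≡⌈δ/2⌉ = trans (count-takeFirst ⌈ δ /2⌉ outside) (m≤n⇒m⊓n≡m (⌈n/2⌉≤n δ))

    seed-black : ∀ w → seedP w ≡ true → lookup seed w ≡ true
    seed-black w = trans (lookup∘tabulate seedP w)

    seed-outside : ∀ w → seedP w ≡ true → f w ≢ r
    seed-outside w w∈seed w∈r with () ← trans (sym (cong not (inPart⁺ w∈r))) (takeFirst-⊆ ⌈ δ /2⌉ outside w w∈seed)

    δ≤2*∣seed∣ : δ ≤ 2 * count seedP
    δ≤2*∣seed∣ = subst (λ x → δ ≤ 2 * x) (sym ∣seed∣≡⌈δ/2⌉) (n≤2*⌈n/2⌉ δ)

    largestPart-black : 1 ≤ δ → ∀ u → f u ≡ r → lookup (step G seed) u ≡ true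
    largestPart-black 1≤δ u u∈r = majority-blackens seed u (subst (1 ≤_) (sym (deg≡δ u∈r)) 1≤δ) (begin
      deg G u                  ≡⟨ deg≡δ u∈r ⟩
      δ                        ≤⟨ δ≤2*∣seed∣ ⟩
      2 * count seedP          ≤⟨ *-monoʳ-≤ 2 (count≤blackNbrs seed u
                                    (λ w w∈seed w~u → seed-outside w w∈seed (trans w~u u∈r)) seed-black) ⟩
      2 * blackNbrs G seed u   ∎)
      where open ≤-Reasoning

    seedOutside : Fin m → Fin N → Bool
    seedOutside i w = seedP w ∧ not (inPart i w)

    largestPart∪seedOutside : Fin m → Fin N → Bool
    largestPart∪seedOutside i w = inPart r w ∨ seedOutside i w

    count-largestPart∪seedOutside : ∀ i → count (largestPart∪seedOutside i) ≡ partSize f r + count (seedOutside i)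
    count-largestPart∪seedOutside i = count-∨-disjoint (inPart r) (seedOutside i) disjoint
      where
      disjoint : ∀ w → inPart r w ∧ seedOutside i w ≡ false
      disjoint w with inPart r w in w∈r | seedP w in w∈seed
      ... | false | _     = refl
      ... | true  | false = refl
      ... | true  | true  = contradiction (inPart⁻ w∈r) (seed-outside w w∈seed)

    largestPart∪seedOutside-black : 1 ≤ δ → ∀ i w → largestPart∪seedOutside i w ≡ true →
      lookup (step G seed) w ≡ true
    largestPart∪seedOutside-black 1≤δ i w black with inPart r w in w∈r
    ... | true  = largestPart-black 1≤δ w (inPart⁻ w∈r)
    ... | false = black-stays-black seed w (seed-black w (∧-conicalˡ (seedP w) _ black))

    seed-dynamo : 1 ≤ δ → ∀ v → lookup (state G seed 2) v ≡ true
    seed-dynamo 1≤δ v with lookup (step G seed) v in white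
    ... | true  = black-stays-black (step G seed) v white
    ... | false = majority-blackens (step G seed) v (≤-trans 1≤δ (δ≤deg v)) (begin
      deg G v                                          ≤⟨ second-round-majority degree δ≤2[c+a] c≤partSize (largest i) ⟩
      2 * (partSize f r + a)                           ≡⟨ cong (2 *_) (count-largestPart∪seedOutside i) ⟨
      2 * count (largestPart∪seedOutside i)            ≤⟨ *-monoʳ-≤ 2 (count≤blackNbrs (step G seed) v
                                                            otherPart (largestPart∪seedOutside-black 1≤δ i)) ⟩
      2 * blackNbrs G (step G seed) v                  ∎)
      where
      open ≤-Reasoning
      i = f v
      a c : ℕ
      a = count (seedOutside i)
      c = count (λ w → seedP w ∧ inPart i w)
      degree : deg G v + partSize f i ≡ partSize f r + δ
      degree = trans (deg+partSize≡N v) (sym partSize+δ≡N)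
      δ≤2[c+a] : δ ≤ 2 * (c + a)
      δ≤2[c+a] = subst (λ x → δ ≤ 2 * x) (count-∧-split seedP (inPart i)) δ≤2*∣seed∣
      c≤partSize : c ≤ partSize f i
      c≤partSize = count-mono (λ w → ∧-conicalʳ (seedP w) (inPart i w))
      otherPart : ∀ w → largestPart∪seedOutside i w ≡ true → f w ≢ f v
      otherPart w black w~v with inPart r w in w∈r
      ... | true  with () ← trans (sym (largestPart-black 1≤δ v (trans (sym w~v) (inPart⁻ w∈r)))) white
      ... | false with () ← trans (sym (cong not (inPart⁺ w~v))) (∧-conicalʳ (seedP w) _ black)

    minDynamoSize : 1 ≤ δ → IsMinDynamoSize G ⌈ δ /2⌉
    minDynamoSize 1≤δ = (seed , (λ v → 2 , seed-dynamo 1≤δ v) , ∣seed∣≡⌈δ/2⌉) , dynamo-lowerBound-δ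

theorem2 : (k : ℕ) → 1 ≤ℕ k → (p : Fin (suc k) → ℕ)
    → (∀ i j → i ≤F j → p j ≤ℕ p i)
    → (∀ i → 1 ≤ℕ p i)
    → (N : ℕ) → (f : Fin N → Fin (suc k))
    → (∀ i → partSize f i ≡ p i)
    → IsMinDynamoSize (multipartite f) ⌈ (sum (tabulate p) ∸ p zero) /2⌉
theorem2 (suc k) _ p p-antitone p-positive N f partSize≡p =
  subst (IsMinDynamoSize (multipartite f)) (cong ⌈_/2⌉ (sym sum∸p₁≡δ)) (minDynamoSize 1≤δ)
  where
  open Multipartite f
  largest : ∀ i → partSize f i ≤ partSize f zero
  largest i = subst₂ _≤_ (sym (partSize≡p i)) (sym (partSize≡p zero)) (p-antitone zero i z≤n)
  open LargestPart zero largest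
  1≤δ : 1 ≤ δ
  1≤δ = ≤-trans (p-positive (suc zero)) (subst (_≤ δ) (partSize≡p (suc zero)) (partSize≤outside λ ()))
  sum∸p₁≡δ : sum (tabulate p) ∸ p zero ≡ δ
  sum∸p₁≡δ = begin
    sum (tabulate p) ∸ p zero              ≡⟨ cong₂ _∸_ sum≡N (sym (partSize≡p zero)) ⟩
    N ∸ partSize f zero                    ≡⟨ cong (_∸ partSize f zero) partSize+δ≡N ⟨
    partSize f zero + δ ∸ partSize f zero  ≡⟨ m+n∸m≡n (partSize f zero) δ ⟩
    δ                                      ∎
    where
    open ≡-Reasoning
    sum≡N : sum (tabulate p) ≡ N
    sum≡N = trans (cong sum (tabulate-cong (sym ∘ partSize≡p))) (sum-partSize f)
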